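{- Let $k\ge 4$ and let $T$ be the tree obtained from a path $v_1v_2\ldots v_k$ by adding a new vertex $w$ and the edge $v_{k-1}w$. Then $\gamma_{tR2}(T)<\frac{2(k+3)}{3}$.
   Context: For a graph $G$ and $f:V(G)\to\{0,1,2\}$ let $V_i=\{v:f(v)=i\}$; $f$ is a total Roman $\{2\}$-dominating function (TR2DF) if every vertex $v$ with $f(v)=0$ has a neighbor $u$ with $f(u)=2$ or two distinct neighbors $x,y$ with $f(x)=f(y)=1$, and the subgraph induced by $V_1\cup V_2$ has no isolated vertices. $\gamma_{tR2}(G)$ is the minimum weight $\sum_v f(v)$ of a TR2DF of $G$. -}

module Defs where

open import Data.Nat using (ℕ; zero; suc; _+_; _*_; _∸_; _<_; _≤_)
open import Data.Fin using (Fin; toℕ)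
open import Data.Product using (Σ; ∃; _×_; _,_)
open import Data.Sum using (_⊎_)
open import Data.Empty using (⊥)
open import Relation.Nullary using (¬_)
open import Relation.Binary.PropositionalEquality using (_≡_)
open import Data.List using (List; map; allFin)
open import Data.Nat.ListAction using (sum)
open import Relation.Binary.PropositionalEquality using (refl)
import Relation.Binary.PropositionalEquality
import Data.Nat.Properties

record Graph : Set₁ where
  field
    n    : ℕ
    Adj  : Fin n → Fin n → Set
    sym  : ∀ {u v} → Adj u v → Adj v u
    irr  : ∀ {v} → ¬ Adj v v
open Graph public

weight : (G : Graph) → (Fin (n G) → ℕ) → ℕ
weight G f = sum (map f (allFin (n G)))

record IsTR2DF (G : Graph) (f : Fin (n G) → ℕ) : Set where
  field
    range  : ∀ v → f v ≤ 2
    dom    : ∀ v → f v ≡ 0 →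
               (Σ (Fin (n G)) λ u → Adj G v u × f u ≡ 2)
             ⊎ (Σ (Fin (n G)) λ x → Σ (Fin (n G)) λ y →
                  ¬ (x ≡ y) × Adj G v x × Adj G v y × f x ≡ 1 × f y ≡ 1)
    total  : ∀ v → ¬ (f v ≡ 0) →
               Σ (Fin (n G)) λ u → Adj G v u × ¬ (f u ≡ 0)

record IsGammaTR2 (G : Graph) (g : ℕ) : Set where
  field
    attained : Σ (Fin (n G) → ℕ) λ f → IsTR2DF G f × weight G f ≡ g
    minimal  : ∀ f → IsTR2DF G f → g ≤ weight G f

-- The tree: path v1..vk (vertex i ↦ toℕ i = i-1 for i<k) plus w = vertex k,
-- attached to v_{k-1} (index k-2).
data TAdjℕ (k : ℕ) : ℕ → ℕ → Set where
  path  : ∀ {i} → suc i < k → TAdjℕ k i (suc i)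
  path' : ∀ {i} → suc i < k → TAdjℕ k (suc i) i
  leaf  : TAdjℕ k (k ∸ 2) k
  leaf' : TAdjℕ k k (k ∸ 2)

-- requires k ≥ 2 for irreflexivity
tree : (k : ℕ) → 2 ≤ k → Graph
tree k h = record
  { n = suc k
  ; Adj = λ u v → TAdjℕ k (toℕ u) (toℕ v)
  ; sym = symT
  ; irr = irrT
  }
  where
  n≢1+n : ∀ m → ¬ (m ≡ suc m)
  n≢1+n zero ()
  n≢1+n (suc m) e = n≢1+n m (Data.Nat.Properties.suc-injective e)
  symT : ∀ {a b} → TAdjℕ k a b → TAdjℕ k b a
  symT (path x) = path' x
  symT (path' x) = path x
  symT leaf = leaf'
  symT leaf' = leaf
  irr' : ∀ {a b} → a ≡ b → ¬ TAdjℕ k a b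
  irr' e (path x) = n≢1+n _ e
  irr' e (path' x) = n≢1+n _ (Relation.Binary.PropositionalEquality.sym e)
  irr' e leaf = k2≢k h e
    where
    k2≢k : 2 ≤ k → ¬ (k ∸ 2 ≡ k)
    k2≢k (Data.Nat.s≤s (Data.Nat.s≤s _)) ()
  irr' e leaf' = k2≢k' h e
    where
    k2≢k' : 2 ≤ k → ¬ (k ≡ k ∸ 2)
    k2≢k' (Data.Nat.s≤s (Data.Nat.s≤s _)) ()
  irrT : ∀ {v} → ¬ TAdjℕ k (toℕ v) (toℕ v)
  irrT = irr' refl

{-# OPTIONS --safe #-}
-- Label the path 1,1,0,1,1,0,… from v₁: every 0 sits between two 1s and every 1 has a
-- labelled neighbour.  At the far end one of three gadgets, chosen by k mod 3, puts a 2
-- on v_{k-1}, which dominates both leaves v_k and w.  Each period of three vertices costs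
-- 2 and the gadgets for k = 4, 5, 6 cost 4, 5, 5, so the weight stays below 2(k+3)/3.
module Submission where

open import Defs
open import Data.Nat using (ℕ; suc; _+_; _*_; _≤_; _<_; z≤n; s≤s)
open import Data.Nat.Properties
  using (≤-trans; <-trans; n<1+n; m∸n≤m; m≤m+n; <ᵇ⇒<; suc-injective; +-comm; *-monoʳ-≤; *-distribˡ-+; +-monoʳ-<; module ≤-Reasoning)
open import Data.Fin using (Fin; toℕ; fromℕ<; #_)
open import Data.Fin.Properties using (toℕ<n; toℕ≤pred[n]; toℕ-fromℕ<)
open import Data.List using (tabulate)
open import Data.List.Properties using (map-tabulate)
open import Data.Nat.ListAction using (sum)
open import Data.Product using (Σ; _×_; _,_)
open import Data.Sum using (_⊎_; inj₁; inj₂)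
open import Function using (_∘_; id)
open import Relation.Nullary using (contradiction)
open import Relation.Binary.PropositionalEquality using (_≡_; _≢_; refl; cong)

Dominated : {V : Set} → (V → V → Set) → (V → ℕ) → V → Set
Dominated {V} Adj h a =
    (Σ V λ b → Adj a b × h b ≡ 2)
  ⊎ (Σ V λ b → Σ V λ c → b ≢ c × Adj a b × Adj a c × h b ≡ 1 × h c ≡ 1)

HasLabelledNeighbour : {V : Set} → (V → V → Set) → (V → ℕ) → V → Set
HasLabelledNeighbour {V} Adj h a = Σ V λ b → Adj a b × h b ≢ 0

record LocallyTR2 {V : Set} (Adj : V → V → Set) (h : V → ℕ) (a : V) : Set where
  constructor locallyTR2
  field
    dominated : h a ≡ 0 → Dominated Adj h a
    supported : h a ≢ 0 → HasLabelledNeighbour Adj h a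

module _ {V : Set} {Adj : V → V → Set} {h : V → ℕ} {a : V} where

  by-2 : ∀ {b} → h a ≡ 0 → Adj a b → h b ≡ 2 → LocallyTR2 Adj h a
  by-2 {b} ha≡0 ab hb≡2 = locallyTR2 (λ _ → inj₁ (b , ab , hb≡2)) λ ha≢0 → contradiction ha≡0 ha≢0

  by-1-1 : ∀ {b c} → h a ≡ 0 → b ≢ c → Adj a b → Adj a c → h b ≡ 1 → h c ≡ 1 → LocallyTR2 Adj h a
  by-1-1 {b} {c} ha≡0 b≢c ab ac hb≡1 hc≡1 =
    locallyTR2 (λ _ → inj₂ (b , c , b≢c , ab , ac , hb≡1 , hc≡1)) λ ha≢0 → contradiction ha≡0 ha≢0

  by-neighbour : ∀ {b} → h a ≢ 0 → Adj a b → h b ≢ 0 → LocallyTR2 Adj h a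
  by-neighbour {b} ha≢0 ab hb≢0 = locallyTR2 (λ ha≡0 → contradiction ha≡0 ha≢0) λ _ → b , ab , hb≢0

next : ∀ {i k} → TAdjℕ (2 + i + k) i (suc i)
next {i} {k} = path (m≤m+n (2 + i) k)

prev : ∀ {i k} → TAdjℕ (2 + i + k) (suc i) i
prev {i} {k} = path' (m≤m+n (2 + i) k)

TAdjℕ-suc : ∀ {k a b} → TAdjℕ (2 + k) a b → TAdjℕ (3 + k) (suc a) (suc b)
TAdjℕ-suc (path p)  = path (s≤s p)
TAdjℕ-suc (path' p) = path' (s≤s p)
TAdjℕ-suc leaf      = leaf
TAdjℕ-suc leaf'     = leaf'

LocallyTR2-suc : ∀ {k h a} → LocallyTR2 (TAdjℕ (2 + k)) (h ∘ suc) a →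
                 LocallyTR2 (TAdjℕ (3 + k)) h (suc a)
LocallyTR2-suc {k} {h} {a} (locallyTR2 dominated supported) =
  locallyTR2 (shiftDominated ∘ dominated) (shiftNeighbour ∘ supported)
  where
  shiftDominated : Dominated (TAdjℕ (2 + k)) (h ∘ suc) a → Dominated (TAdjℕ (3 + k)) h (suc a)
  shiftDominated (inj₁ (b , ab , hb≡2)) = inj₁ (suc b , TAdjℕ-suc ab , hb≡2)
  shiftDominated (inj₂ (b , c , b≢c , ab , ac , hb≡1 , hc≡1)) =
    inj₂ (suc b , suc c , b≢c ∘ suc-injective , TAdjℕ-suc ab , TAdjℕ-suc ac , hb≡1 , hc≡1)
  shiftNeighbour : HasLabelledNeighbour (TAdjℕ (2 + k)) (h ∘ suc) a →
                   HasLabelledNeighbour (TAdjℕ (3 + k)) h (suc a)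
  shiftNeighbour (b , ab , hb≢0) = suc b , TAdjℕ-suc ab , hb≢0

-- The labelling for k = 4 + t; the gadgets read 1 1 2 0 | 0, 1 1 1 2 0 | 0 and
-- 1 1 0 1 2 0 | 0, the value after the bar being that of w.
labelFin : ℕ → ℕ → Fin 3
labelFin (suc (suc (suc t))) 0 = # 1
labelFin (suc (suc (suc t))) 1 = # 1
labelFin (suc (suc (suc t))) 2 = # 0
labelFin (suc (suc (suc t))) (suc (suc (suc i))) = labelFin t i
labelFin 0 0 = # 1
labelFin 0 1 = # 1
labelFin 0 2 = # 2
labelFin 1 0 = # 1
labelFin 1 1 = # 1
labelFin 1 2 = # 1
labelFin 1 3 = # 2
labelFin 2 0 = # 1
labelFin 2 1 = # 1
labelFin 2 2 = # 0
labelFin 2 3 = # 1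
labelFin 2 4 = # 2
labelFin _ _ = # 0

label : ℕ → ℕ → ℕ
label t = toℕ ∘ labelFin t

label≤2 : ∀ t a → label t a ≤ 2
label≤2 t a = toℕ≤pred[n] (labelFin t a)

label-head : ∀ t → label t 0 ≡ 1
label-head 0 = refl
label-head 1 = refl
label-head 2 = refl
label-head (suc (suc (suc t))) = refl

locallyTR2-label : ∀ t a → a < 5 + t → LocallyTR2 (TAdjℕ (4 + t)) (label t) a
locallyTR2-label 0 0 _ = by-neighbour (λ ()) next (λ ())
locallyTR2-label 0 1 _ = by-neighbour (λ ()) prev (λ ())
locallyTR2-label 0 2 _ = by-neighbour (λ ()) prev (λ ())
locallyTR2-label 0 3 _ = by-2 refl prev refl
locallyTR2-label 0 4 _ = by-2 refl leaf' refl
locallyTR2-label 0 (suc (suc (suc (suc (suc _))))) (s≤s (s≤s (s≤s (s≤s (s≤s ())))))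
locallyTR2-label 1 0 _ = by-neighbour (λ ()) next (λ ())
locallyTR2-label 1 1 _ = by-neighbour (λ ()) prev (λ ())
locallyTR2-label 1 2 _ = by-neighbour (λ ()) prev (λ ())
locallyTR2-label 1 3 _ = by-neighbour (λ ()) prev (λ ())
locallyTR2-label 1 4 _ = by-2 refl prev refl
locallyTR2-label 1 5 _ = by-2 refl leaf' refl
locallyTR2-label 1 (suc (suc (suc (suc (suc (suc _)))))) (s≤s (s≤s (s≤s (s≤s (s≤s (s≤s ()))))))
locallyTR2-label 2 0 _ = by-neighbour (λ ()) next (λ ())
locallyTR2-label 2 1 _ = by-neighbour (λ ()) prev (λ ())
locallyTR2-label 2 2 _ = by-1-1 refl (λ ()) prev next refl refl
locallyTR2-label 2 3 _ = by-neighbour (λ ()) next (λ ())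
locallyTR2-label 2 4 _ = by-neighbour (λ ()) prev (λ ())
locallyTR2-label 2 5 _ = by-2 refl prev refl
locallyTR2-label 2 6 _ = by-2 refl leaf' refl
locallyTR2-label 2 (suc (suc (suc (suc (suc (suc (suc _))))))) (s≤s (s≤s (s≤s (s≤s (s≤s (s≤s (s≤s ())))))))
locallyTR2-label (suc (suc (suc t))) 0 _ = by-neighbour (λ ()) next (λ ())
locallyTR2-label (suc (suc (suc t))) 1 _ = by-neighbour (λ ()) prev (λ ())
locallyTR2-label (suc (suc (suc t))) 2 _ = by-1-1 refl (λ ()) prev next refl (label-head t)
locallyTR2-label (suc (suc (suc t))) (suc (suc (suc a))) (s≤s (s≤s (s≤s a<5+t))) =
  LocallyTR2-suc (LocallyTR2-suc (LocallyTR2-suc (locallyTR2-label t a a<5+t)))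

TAdjℕ-bounded : ∀ {k a b} → TAdjℕ k a b → b < suc k
TAdjℕ-bounded {k}         (path p)  = <-trans p (n<1+n k)
TAdjℕ-bounded {k} {suc i} (path' p) = <-trans (n<1+n i) (<-trans p (n<1+n k))
TAdjℕ-bounded {k}         leaf      = n<1+n k
TAdjℕ-bounded {k}         leaf'     = s≤s (m∸n≤m k 2)

module _ (k : ℕ) (hk : 2 ≤ k) (h : ℕ → ℕ) where

  private
    neighbour : ∀ {a b} → TAdjℕ k a b → Σ (Fin (suc k)) λ u → toℕ u ≡ b
    neighbour ab = fromℕ< (TAdjℕ-bounded ab) , toℕ-fromℕ< (TAdjℕ-bounded ab)

  Dominated-tree : ∀ {v} → Dominated (TAdjℕ k) h (toℕ v) → Dominated (Adj (tree k hk)) (h ∘ toℕ) v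
  Dominated-tree (inj₁ (b , vb , hb≡2)) with neighbour vb
  ... | u , refl = inj₁ (u , vb , hb≡2)
  Dominated-tree (inj₂ (b , c , b≢c , vb , vc , hb≡1 , hc≡1)) with neighbour vb | neighbour vc
  ... | x , refl | y , refl = inj₂ (x , y , b≢c ∘ cong toℕ , vb , vc , hb≡1 , hc≡1)

  HasLabelledNeighbour-tree : ∀ {v} → HasLabelledNeighbour (TAdjℕ k) h (toℕ v) →
                              HasLabelledNeighbour (Adj (tree k hk)) (h ∘ toℕ) v
  HasLabelledNeighbour-tree (b , vb , hb≢0) with neighbour vb
  ... | u , refl = u , vb , hb≢0

  tree-TR2DF : (∀ a → h a ≤ 2) → (∀ a → a < suc k → LocallyTR2 (TAdjℕ k) h a) →
               IsTR2DF (tree k hk) (h ∘ toℕ)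
  tree-TR2DF h≤2 local = record
    { range = h≤2 ∘ toℕ
    ; dom   = λ v → Dominated-tree ∘ LocallyTR2.dominated (local (toℕ v) (toℕ<n v))
    ; total = λ v → HasLabelledNeighbour-tree ∘ LocallyTR2.supported (local (toℕ v) (toℕ<n v))
    }

label-TR2DF : ∀ t hk → IsTR2DF (tree (4 + t) hk) (label t ∘ toℕ)
label-TR2DF t hk = tree-TR2DF (4 + t) hk (label t) (label≤2 t) (locallyTR2-label t)

weight≡sum-tabulate : ∀ G f → weight G f ≡ sum (tabulate f)
weight≡sum-tabulate G f = cong sum (map-tabulate id f)

labelWeight : ℕ → ℕ
labelWeight t = sum (tabulate {n = 5 + t} (label t ∘ toℕ))

labelWeight-bound : ∀ t → 3 * labelWeight t < 2 * (7 + t)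
labelWeight-bound 0 = <ᵇ⇒< 12 14 _
labelWeight-bound 1 = <ᵇ⇒< 15 16 _
labelWeight-bound 2 = <ᵇ⇒< 15 18 _
-- labelWeight (3 + t) computes to 2 + labelWeight t.
labelWeight-bound (suc (suc (suc t))) = begin-strict
  3 * (2 + labelWeight t)  ≡⟨ *-distribˡ-+ 3 2 (labelWeight t) ⟩
  6 + 3 * labelWeight t    <⟨ +-monoʳ-< 6 (labelWeight-bound t) ⟩
  6 + 2 * (7 + t)          ≡⟨ *-distribˡ-+ 2 3 (7 + t) ⟨
  2 * (10 + t)             ∎
  where open ≤-Reasoning

mainTheorem17 : (k : ℕ) → (hk : 4 ≤ k) → (g : ℕ) →
    IsGammaTR2 (tree k (≤-trans (Data.Nat.s≤s (Data.Nat.s≤s Data.Nat.z≤n)) hk)) g →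
    3 * g < 2 * (k + 3)
mainTheorem17 (suc (suc (suc (suc t)))) hk@(s≤s (s≤s (s≤s (s≤s z≤n)))) g γ = begin-strict
  3 * g                   ≤⟨ *-monoʳ-≤ 3 (IsGammaTR2.minimal γ f (label-TR2DF t 2≤k)) ⟩
  3 * weight G f          ≡⟨ cong (3 *_) (weight≡sum-tabulate G f) ⟩
  3 * labelWeight t       <⟨ labelWeight-bound t ⟩
  2 * (7 + t)             ≡⟨ cong (2 *_) (+-comm 3 (4 + t)) ⟩
  2 * (4 + t + 3)         ∎
  where
  open ≤-Reasoning
  2≤k : 2 ≤ 4 + t
  2≤k = ≤-trans (s≤s (s≤s z≤n)) hk
  G : Graph
  G = tree (4 + t) 2≤k
  f : Fin (5 + t) → ℕ
  f = label t ∘ toℕ
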